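{- Let $G$ be a finite simple graph which is claw free and whose complement $G^c$ has no induced $4$-cycle. Let $L^2=L(I(G)^2)$ and $L=L(I(G))$, and let $m\in L^2$ be squarefree. Then $(1,m]_{L^2}=(1,m]_{L_4}$.
   Context: The edge ideal is $I(G)=(x_ix_j:\ \{i,j\}\in E(G))$ in a polynomial ring over a field with variables indexed by $V(G)$; $G^c$ is the graph on $V(G)$ whose edges are the non-edges of $G$; $G$ is claw free if no $4$ vertices induce a star $K_{1,3}$. The lcm-lattice $L(I)$ of a monomial ideal $I$ is the set of least common multiples of subsets of the minimal monomial generators (the empty subset giving $1$), ordered by divisibility. $L_4$ is the restriction of $L$ to monomials of degree at least $4$. For a poset $P$ of monomials, $(1,m]_P$ is the set of $p\in P$ with $p\neq 1$ and $p\mid m$. -}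

module Defs where

open import Data.Nat using (ℕ; zero; suc; _+_; _≤_; _⊔_)
open import Data.Fin using (Fin)
open import Data.Fin.Properties using (_≟_)
open import Data.List using (List; []; _∷_)
open import Data.List.Relation.Unary.All using (All)
open import Data.Product using (Σ; _×_; ∃; ∃-syntax)
open import Data.Empty using (⊥)
open import Relation.Nullary using (¬_; Dec; yes; no)
open import Relation.Binary.PropositionalEquality using (_≡_; _≢_)
import Data.Vec.Functional as VF

record Graph (n : ℕ) : Set₁ where
  field
    Adj   : Fin n → Fin n → Set
    adj?  : ∀ i j → Dec (Adj i j)
    sym   : ∀ {i j} → Adj i j → Adj j i
    irrefl : ∀ i → ¬ Adj i i
open Graph public

-- G is claw free: no 4 vertices inducing K_{1,3}
-- (centre a adjacent to b, c, d; b, c, d distinct and pairwise non-adjacent;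
--  a is distinct from b, c, d by irreflexivity).
ClawFree : ∀ {n} → Graph n → Set
ClawFree {n} G = ¬ (Σ (Fin n) λ a → Σ (Fin n) λ b → Σ (Fin n) λ c → Σ (Fin n) λ d →
  Adj G a b × Adj G a c × Adj G a d ×
  b ≢ c × b ≢ d × c ≢ d ×
  ¬ Adj G b c × ¬ Adj G b d × ¬ Adj G c d)

AdjC : ∀ {n} → Graph n → Fin n → Fin n → Set
AdjC G i j = i ≢ j × ¬ Adj G i j

NoInducedC4Compl : ∀ {n} → Graph n → Set
NoInducedC4Compl {n} G = ¬ (Σ (Fin n) λ a → Σ (Fin n) λ b → Σ (Fin n) λ c → Σ (Fin n) λ d →
  a ≢ b × a ≢ c × a ≢ d × b ≢ c × b ≢ d × c ≢ d ×
  AdjC G a b × AdjC G b c × AdjC G c d × AdjC G d a ×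
  ¬ AdjC G a c × ¬ AdjC G b d)

-- Monomials in variables x_i, i : Fin n, as exponent vectors.
Mon : ℕ → Set
Mon n = Fin n → ℕ

_≈ₘ_ : ∀ {n} → Mon n → Mon n → Set
p ≈ₘ q = ∀ i → p i ≡ q i

one : ∀ {n} → Mon n
one _ = 0

_·_ : ∀ {n} → Mon n → Mon n → Mon n
(p · q) i = p i + q i

lcmₘ : ∀ {n} → Mon n → Mon n → Mon n
lcmₘ p q i = p i ⊔ q i

_∣ₘ_ : ∀ {n} → Mon n → Mon n → Set
p ∣ₘ q = ∀ i → p i ≤ q i

deg : ∀ {n} → Mon n → ℕ
deg p = VF.foldr _+_ 0 p

Squarefree : ∀ {n} → Mon n → Set
Squarefree m = ∀ i → m i ≤ 1

var : ∀ {n} → Fin n → Mon n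
var i j with i ≟ j
... | yes _ = 1
... | no _  = 0

lcmList : ∀ {n} → List (Mon n) → Mon n
lcmList []       = one
lcmList (p ∷ ps) = lcmₘ p (lcmList ps)

GenI : ∀ {n} → Graph n → Mon n → Set
GenI {n} G p = ∃[ i ] ∃[ j ] (Adj G i j × p ≈ₘ (var i · var j))

-- minimal monomial generators of I(G)^2: products of two edge monomials
-- (all of degree 4, hence pairwise incomparable, so all minimal)
GenI2 : ∀ {n} → Graph n → Mon n → Set
GenI2 {n} G p = ∃[ i ] ∃[ j ] ∃[ k ] ∃[ l ]
  (Adj G i j × Adj G k l × p ≈ₘ ((var i · var j) · (var k · var l)))

-- lcm-lattice of the ideal with minimal generating set Gen:
-- lcms of finite subsets of generators (the empty subset giving 1)
InLcmLattice : ∀ {n} → (Mon n → Set) → Mon n → Set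
InLcmLattice {n} Gen p = Σ (List (Mon n)) λ S → All Gen S × lcmList S ≈ₘ p

-- L = L(I(G)), L^2 = L(I(G)^2), L_4 = elements of L of degree ≥ 4
InL : ∀ {n} → Graph n → Mon n → Set
InL G = InLcmLattice (GenI G)

InL2 : ∀ {n} → Graph n → Mon n → Set
InL2 G = InLcmLattice (GenI2 G)

InL4 : ∀ {n} → Graph n → Mon n → Set
InL4 G p = InL G p × 4 ≤ deg p

-- (1, m]_P : elements p of P with p ≠ 1 and p ∣ m
InHalfOpen : ∀ {n} → (Mon n → Set) → Mon n → Mon n → Set
InHalfOpen P m p = P p × ¬ (p ≈ₘ one) × p ∣ₘ m

-- Every monomial p in either half-open interval divides the squarefree m, so
-- it is squarefree. A squarefree product of two edge monomials is their lcm, so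
-- elements of L² lie in L, and they have degree at least 4. Conversely, let
-- p ∈ L be squarefree of degree at least 4. Every vertex of supp p lies on an
-- edge inside supp p, and supp p has at least four vertices; claw-freeness then
-- puts every vertex v of supp p on two disjoint edges inside supp p, i.e. gives
-- a generator of I(G)² dividing p and divisible by x_v. Each edge x_i x_j of p
-- divides the lcm of the generators obtained for i and j, hence p ∈ L².
module Submission where

open import Defs renaming (sym to adj-sym)
open import Data.Nat using (ℕ; zero; suc; _+_; _∸_; _≤_; _<_; _⊔_; z≤n; s≤s; s≤s⁻¹)
open import Data.Nat.Properties hiding (_≟_)
open import Data.Fin using (Fin) renaming (zero to fzero; suc to fsuc)
open import Data.Fin.Properties using (_≟_)
open import Data.List using (List; []; _∷_; _++_; length)
open import Data.List.Relation.Unary.All using (All; []; _∷_)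
open import Data.List.Relation.Unary.All.Properties using (++⁺)
open import Data.Product using (Σ; _×_; _,_; ∃-syntax)
open import Data.Sum using (_⊎_; inj₁; inj₂)
open import Data.Empty using (⊥-elim)
open import Relation.Nullary using (¬_; Dec; yes; no)
open import Relation.Binary.PropositionalEquality
open import Algebra.Properties.CommutativeSemigroup +-commutativeSemigroup using (interchange)

private
  variable
    n : ℕ
    f g p q : Mon n
    i j t u v x : Fin n

Support : Mon n → Fin n → Set
Support f t = 1 ≤ f t

var-diag : (x : Fin n) → var x x ≡ 1
var-diag x with x ≟ x
... | yes _  = refl
... | no x≢x = ⊥-elim (x≢x refl)

var-≢ : x ≢ t → var x t ≡ 0
var-≢ {x = x} {t} x≢t with x ≟ t
... | yes x≡t = ⊥-elim (x≢t x≡t)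
... | no _    = refl

var-support : Support (var x) t → x ≡ t
var-support {x = x} {t} _ with x ≟ t
var-support _  | yes x≡t = x≡t
var-support () | no _

var-suc : (x i : Fin n) → var (fsuc x) (fsuc i) ≡ var x i
var-suc x i with x ≟ i
... | yes _ = refl
... | no _  = refl

edge-hasˡ : (i j : Fin n) → Support (var i · var j) i
edge-hasˡ i j = ≤-trans (≤-reflexive (sym (var-diag i))) (m≤m+n (var i i) (var j i))

edge-hasʳ : (i j : Fin n) → Support (var i · var j) j
edge-hasʳ i j = ≤-trans (≤-reflexive (sym (var-diag j))) (m≤n+m (var j j) (var i j))

edge-support : Support (var i · var j) t → i ≡ t ⊎ j ≡ t
edge-support {i = i} {j} {t} h with i ≟ t
... | yes i≡t = inj₁ i≡t
... | no _    = inj₂ (var-support h)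

squarefree-∣ₘ : Squarefree q → (∀ t → Support q t → Support f t) → q ∣ₘ f
squarefree-∣ₘ {q = q} {f = f} sq supp t with q t | sq t | supp t
... | zero     | _         | _ = z≤n
... | suc zero | _         | h = h (s≤s z≤n)
... | suc (suc _) | s≤s () | _

-- Degree

deg-cong : f ≈ₘ g → deg f ≡ deg g
deg-cong {zero}  _   = refl
deg-cong {suc n} f≈g = cong₂ _+_ (f≈g fzero) (deg-cong (λ i → f≈g (fsuc i)))

deg-mono : f ∣ₘ g → deg f ≤ deg g
deg-mono {zero}  _   = z≤n
deg-mono {suc n} f∣g = +-mono-≤ (f∣g fzero) (deg-mono (λ i → f∣g (fsuc i)))

deg-· : (f g : Mon n) → deg (f · g) ≡ deg f + deg g
deg-· {zero}  f g = refl
deg-· {suc n} f g = begin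
  (f fzero + g fzero) + deg ((f · g) ∘suc)         ≡⟨ cong (f fzero + g fzero +_) (deg-· (f ∘suc) (g ∘suc)) ⟩
  (f fzero + g fzero) + (deg (f ∘suc) + deg (g ∘suc)) ≡⟨ interchange (f fzero) (g fzero) _ _ ⟩
  (f fzero + deg (f ∘suc)) + (g fzero + deg (g ∘suc)) ∎
  where
  open ≡-Reasoning
  _∘suc : ∀ {n} → Mon (suc n) → Mon n
  (h ∘suc) i = h (fsuc i)

deg-one : deg (one {n}) ≡ 0
deg-one {zero}  = refl
deg-one {suc n} = deg-one {n}

deg-var : (x : Fin n) → deg (var x) ≡ 1
deg-var {suc n} fzero =
  cong suc (trans (deg-cong {n} {g = one} λ i → var-≢ {x = fzero} {fsuc i} λ ()) (deg-one {n}))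
deg-var {suc n} (fsuc x) =
  cong₂ _+_ (var-≢ {x = fsuc x} {fzero} λ ()) (trans (deg-cong (var-suc x)) (deg-var x))

deg-GenI2 : (G : Graph n) → GenI2 G q → deg q ≡ 4
deg-GenI2 {q = q} G (i , j , k , l , _ , _ , q≈) = begin
  deg q                                       ≡⟨ deg-cong q≈ ⟩
  deg ((var i · var j) · (var k · var l))     ≡⟨ deg-· (var i · var j) (var k · var l) ⟩
  deg (var i · var j) + deg (var k · var l)   ≡⟨ cong₂ _+_ (deg-· (var i) (var j)) (deg-· (var k) (var l)) ⟩
  (deg (var i) + deg (var j)) + (deg (var k) + deg (var l))
    ≡⟨ cong₂ _+_ (cong₂ _+_ (deg-var i) (deg-var j)) (cong₂ _+_ (deg-var k) (deg-var l)) ⟩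
  4                                           ∎
  where open ≡-Reasoning

deg-support : 1 ≤ deg f → ∃[ t ] Support f t
deg-support {suc n} {f} h with f fzero in eq
... | suc _ = fzero , subst (1 ≤_) (sym eq) (s≤s z≤n)
... | zero  with deg-support {f = λ i → f (fsuc i)} h
...   | t , ft = fsuc t , ft

lower : Mon n → Fin n → Mon n
lower f x t = f t ∸ var x t

lower-∣ₘ : (f : Mon n) (x : Fin n) → lower f x ∣ₘ f
lower-∣ₘ f x t = m∸n≤m (f t) (var x t)

deg-lower : (f : Mon n) (x : Fin n) → deg f ≤ suc (deg (lower f x))
deg-lower f x = begin
  deg f                          ≤⟨ deg-mono (λ t → m≤n+m∸n (f t) (var x t)) ⟩
  deg (var x · lower f x)        ≡⟨ deg-· (var x) (lower f x) ⟩
  deg (var x) + deg (lower f x)  ≡⟨ cong (_+ deg (lower f x)) (deg-var x) ⟩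
  suc (deg (lower f x))          ∎
  where open ≤-Reasoning

lower-squarefree : Squarefree f → (x : Fin n) → lower f x x ≡ 0
lower-squarefree {f = f} sq x rewrite var-diag x = n≤1⇒n∸1≡0 (sq x)
  where
  n≤1⇒n∸1≡0 : ∀ {k} → k ≤ 1 → k ∸ 1 ≡ 0
  n≤1⇒n∸1≡0 z≤n       = refl
  n≤1⇒n∸1≡0 (s≤s z≤n) = refl

fresh-support : Squarefree p → (xs : List (Fin n)) → length xs < deg p →
                ∃[ t ] Support p t × All (_≢ t) xs
fresh-support {p = p} sq [] h with deg-support {f = p} h
... | t , pt = t , pt , []
fresh-support {p = p} sq (x ∷ xs) h
  with fresh-support {p = lower p x} (λ t → ≤-trans (lower-∣ₘ p x t) (sq t)) xs
         (s≤s⁻¹ (≤-trans h (deg-lower p x)))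
... | t , lt , fresh = t , ≤-trans lt (lower-∣ₘ p x t) , x≢t ∷ fresh
  where
  x≢t : x ≢ t
  x≢t refl with ≤-trans lt (≤-reflexive (lower-squarefree sq x))
  ... | ()

-- lcm lattices

lcmList-least : (S : List (Mon n)) → All (_∣ₘ f) S → lcmList S ∣ₘ f
lcmList-least []      []           t = z≤n
lcmList-least (q ∷ S) (q∣f ∷ S∣f) t = ⊔-lub (q∣f t) (lcmList-least S S∣f t)

lcmList-++ : (S T : List (Mon n)) → lcmList (S ++ T) ≈ₘ lcmₘ (lcmList S) (lcmList T)
lcmList-++ []      T t = refl
lcmList-++ (q ∷ S) T t =
  trans (cong (q t ⊔_) (lcmList-++ S T t)) (sym (⊔-assoc (q t) (lcmList S t) (lcmList T t)))

lcmList-support : {P : Mon n → Set} (S : List (Mon n)) → All P S → Support (lcmList S) t →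
                  ∃[ q ] P q × q ∣ₘ lcmList S × Support q t
lcmList-support {t = t} (q ∷ S) (Pq ∷ PS) h with q t in eq
... | suc _ = q , Pq , (λ s → m≤m⊔n (q s) _) , subst (1 ≤_) (sym eq) (s≤s z≤n)
... | zero  with lcmList-support S PS h
...   | r , Pr , r∣S , rt = r , Pr , (λ s → ≤-trans (r∣S s) (m≤n⊔m (q s) _)) , rt

InLcmLattice-nontrivial : {Gen : Mon n → Set} → InLcmLattice Gen p → ¬ p ≈ₘ one →
                          ∃[ q ] Gen q × q ∣ₘ p
InLcmLattice-nontrivial ([]    , []       , 1≈p) p≉1 = ⊥-elim (p≉1 (λ t → sym (1≈p t)))
InLcmLattice-nontrivial (q ∷ S , Gq ∷ _ , S≈p) _   =
  q , Gq , λ t → subst (q t ≤_) (S≈p t) (m≤m⊔n (q t) _)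

Refines : (Gen Gen′ : Mon n → Set) → Mon n → Set
Refines {n} Gen Gen′ p = ∀ {e} → Gen e → e ∣ₘ p →
  Σ (List (Mon n)) λ T → All Gen′ T × lcmList T ∣ₘ p × e ∣ₘ lcmList T

InLcmLattice-refine : {Gen Gen′ : Mon n → Set} → Refines Gen Gen′ p →
                      InLcmLattice Gen p → InLcmLattice Gen′ p
InLcmLattice-refine {n} {p} {Gen} {Gen′} refine (S , GS , S≈p) =
  let T , GT , T∣p , S∣T = cover S GS (λ t → ≤-reflexive (S≈p t)) in
  T , GT , λ t → ≤-antisym (T∣p t) (subst (_≤ lcmList T t) (S≈p t) (S∣T t))
  where
  cover : (S : List (Mon n)) → All Gen S → lcmList S ∣ₘ p →
          Σ (List (Mon n)) λ T → All Gen′ T × lcmList T ∣ₘ p × lcmList S ∣ₘ lcmList T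
  cover []      []        _   = [] , [] , (λ _ → z≤n) , (λ _ → z≤n)
  cover (e ∷ S) (Ge ∷ GS) e∷S∣p
    with refine Ge (λ t → ≤-trans (m≤m⊔n (e t) _) (e∷S∣p t))
       | cover S GS (λ t → ≤-trans (m≤n⊔m (e t) _) (e∷S∣p t))
  ... | Tₑ , GTₑ , Tₑ∣p , e∣Tₑ | T , GT , T∣p , S∣T =
    Tₑ ++ T , ++⁺ GTₑ GT ,
    (λ t → subst (_≤ p t) (sym (lcmList-++ Tₑ T t)) (⊔-lub (Tₑ∣p t) (T∣p t))) ,
    (λ t → subst (_ ≤_) (sym (lcmList-++ Tₑ T t)) (⊔-mono-≤ (e∣Tₑ t) (S∣T t)))

m+n≤1⇒m+n≤m⊔n : ∀ {k l} → k + l ≤ 1 → k + l ≤ k ⊔ l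
m+n≤1⇒m+n≤m⊔n {zero}  {l}     _         = ≤-refl
m+n≤1⇒m+n≤m⊔n {suc k} {zero}  _         = ≤-reflexive (+-identityʳ (suc k))
m+n≤1⇒m+n≤m⊔n {suc k} {suc l} (s≤s k+1+l≤0)
  with subst (_≤ 0) (+-suc k l) k+1+l≤0
... | ()

GenI2-refines-GenI : (G : Graph n) → Squarefree p → Refines (GenI2 G) (GenI G) p
GenI2-refines-GenI {p = p} G sq {e} (i , j , k , l , i~j , k~l , e≈) e∣p =
  eᵢⱼ ∷ eₖₗ ∷ [] ,
  (i , j , i~j , λ _ → refl) ∷ (k , l , k~l , λ _ → refl) ∷ [] ,
  (λ t → ⊔-lub (≤-trans (m≤m+n (eᵢⱼ t) (eₖₗ t)) (e∣p′ t))
               (⊔-lub (≤-trans (m≤n+m (eₖₗ t) (eᵢⱼ t)) (e∣p′ t)) z≤n)) ,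
  e∣lcm
  where
  eᵢⱼ eₖₗ : Mon _
  eᵢⱼ = var i · var j
  eₖₗ = var k · var l

  e∣p′ : (eᵢⱼ · eₖₗ) ∣ₘ p
  e∣p′ t = subst (_≤ p t) (e≈ t) (e∣p t)

  e∣lcm : e ∣ₘ lcmList (eᵢⱼ ∷ eₖₗ ∷ [])
  e∣lcm t = begin
    e t                  ≡⟨ e≈ t ⟩
    eᵢⱼ t + eₖₗ t        ≤⟨ m+n≤1⇒m+n≤m⊔n {eᵢⱼ t} (≤-trans (e∣p′ t) (sq t)) ⟩
    eᵢⱼ t ⊔ eₖₗ t        ≡⟨ cong (eᵢⱼ t ⊔_) (sym (⊔-identityʳ (eₖₗ t))) ⟩
    eᵢⱼ t ⊔ (eₖₗ t ⊔ 0)  ∎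
    where open ≤-Reasoning

-- Claw-free graphs

record TwoEdgesAt (G : Graph n) (U : Fin n → Set) (v : Fin n) : Set where
  constructor twoEdges
  field
    b c d : Fin n
    v~b : Adj G v b
    c~d : Adj G c d
    v≢c : v ≢ c
    v≢d : v ≢ d
    b≢c : b ≢ c
    b≢d : b ≢ d
    Ub  : U b
    Uc  : U c
    Ud  : U d

adj⇒≢ : (G : Graph n) → Adj G x u → x ≢ u
adj⇒≢ G x~u refl = irrefl G _ x~u

claw-free-neighbours : (G : Graph n) → ClawFree G → ∀ {a b c d} →
                       Adj G c a → Adj G c b → Adj G c d → a ≢ b → a ≢ d → b ≢ d →
                       ¬ Adj G b d → Adj G a b ⊎ Adj G a d
claw-free-neighbours G claw-free {a} {b} {c} {d} c~a c~b c~d a≢b a≢d b≢d b≁d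
  with adj? G a b | adj? G a d
... | yes a~b | _       = inj₁ a~b
... | no _    | yes a~d = inj₂ a~d
... | no a≁b  | no a≁d  =
  ⊥-elim (claw-free (c , a , b , d , c~a , c~b , c~d , a≢b , a≢d , b≢d , a≁b , a≁d , b≁d))

module _ (G : Graph n) (claw-free : ClawFree G) (U : Fin n → Set)
         (neighbour : ∀ {w} → U w → ∃[ x ] Adj G w x × U x)
         (v~u : Adj G v u) (Uu : U u) where

  private
    crossed : ∀ {w₁ w₂} → U w₁ → U w₂ → u ≢ w₁ → v ≢ w₂ → w₁ ≢ w₂ →
              Adj G v w₁ → Adj G u w₂ → TwoEdgesAt G U v
    crossed {w₁} {w₂} U₁ U₂ u≢₁ v≢₂ ₁≢₂ v~₁ u~₂ =
      twoEdges w₁ u w₂ v~₁ u~₂ (adj⇒≢ G v~u) v≢₂ (≢-sym u≢₁) ₁≢₂ U₁ Uu U₂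

    attach : ∀ {w} → U w → u ≢ w → v ≢ w → TwoEdgesAt G U v ⊎ (Adj G w u ⊎ Adj G w v)
    attach {w} Uw u≢w v≢w with neighbour Uw
    ... | x , w~x , Ux with x ≟ u | x ≟ v
    ...   | yes refl | _        = inj₂ (inj₁ w~x)
    ...   | no _     | yes refl = inj₂ (inj₂ w~x)
    ...   | no x≢u   | no x≢v   =
      inj₁ (twoEdges u w x v~u w~x v≢w (≢-sym x≢v) u≢w (≢-sym x≢u) Uu Uw Ux)

  -- Each wₖ either lies on an edge disjoint from vu or is adjacent to u or v.
  -- If w₁ ≁ w₂ are both adjacent to the same endpoint of vu, claw-freeness at
  -- that endpoint joins the other endpoint to one of them.
  edge-twoEdgesAt : ∀ {w₁ w₂} → U w₁ → U w₂ →
                    u ≢ w₁ → v ≢ w₁ → u ≢ w₂ → v ≢ w₂ → w₁ ≢ w₂ → TwoEdgesAt G U v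
  edge-twoEdgesAt {w₁} {w₂} U₁ U₂ u≢₁ v≢₁ u≢₂ v≢₂ ₁≢₂
    with adj? G w₁ w₂ | attach U₁ u≢₁ v≢₁ | attach U₂ u≢₂ v≢₂
  ... | yes ₁~₂ | _ | _ = twoEdges u w₁ w₂ v~u ₁~₂ v≢₁ v≢₂ u≢₁ u≢₂ Uu U₁ U₂
  ... | no _ | inj₁ two | _ = two
  ... | no _ | _ | inj₁ two = two
  ... | no _ | inj₂ (inj₂ ₁~v) | inj₂ (inj₁ ₂~u) = crossed U₁ U₂ u≢₁ v≢₂ ₁≢₂ (adj-sym G ₁~v) (adj-sym G ₂~u)
  ... | no _ | inj₂ (inj₁ ₁~u) | inj₂ (inj₂ ₂~v) = crossed U₂ U₁ u≢₂ v≢₁ (≢-sym ₁≢₂) (adj-sym G ₂~v) (adj-sym G ₁~u)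
  ... | no ₁≁₂ | inj₂ (inj₁ ₁~u) | inj₂ (inj₁ ₂~u)
    with claw-free-neighbours G claw-free (adj-sym G v~u) (adj-sym G ₁~u) (adj-sym G ₂~u) v≢₁ v≢₂ ₁≢₂ ₁≁₂
  ...   | inj₁ v~₁ = crossed U₁ U₂ u≢₁ v≢₂ ₁≢₂ v~₁ (adj-sym G ₂~u)
  ...   | inj₂ v~₂ = crossed U₂ U₁ u≢₂ v≢₁ (≢-sym ₁≢₂) v~₂ (adj-sym G ₁~u)
  edge-twoEdgesAt {w₁} {w₂} U₁ U₂ u≢₁ v≢₁ u≢₂ v≢₂ ₁≢₂
      | no ₁≁₂ | inj₂ (inj₂ ₁~v) | inj₂ (inj₂ ₂~v)
    with claw-free-neighbours G claw-free v~u (adj-sym G ₁~v) (adj-sym G ₂~v) u≢₁ u≢₂ ₁≢₂ ₁≁₂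
  ...   | inj₁ u~₁ = crossed U₂ U₁ u≢₂ v≢₁ (≢-sym ₁≢₂) (adj-sym G ₂~v) u~₁
  ...   | inj₂ u~₂ = crossed U₁ U₂ u≢₁ v≢₂ ₁≢₂ (adj-sym G ₁~v) u~₂

distinct-vars-∣ₘ : ∀ {a b c d} → a ≢ b → a ≢ c → a ≢ d → b ≢ c → b ≢ d → c ≢ d →
                   Support p a → Support p b → Support p c → Support p d →
                   ((var a · var b) · (var c · var d)) ∣ₘ p
distinct-vars-∣ₘ {p = p} {a} {b} {c} {d} a≢b a≢c a≢d b≢c b≢d c≢d pa pb pc pd t =
  bound t (a ≟ t) (b ≟ t) (c ≟ t) (d ≟ t)
  where
  Q : Mon _
  Q = (var a · var b) · (var c · var d)

  evaluate : ∀ {t k l r s} → var a t ≡ k → var b t ≡ l → var c t ≡ r → var d t ≡ s →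
             (k + l) + (r + s) ≤ p t → Q t ≤ p t
  evaluate {t} eᵃ eᵇ eᶜ eᵈ = subst (_≤ p t) (sym (cong₂ _+_ (cong₂ _+_ eᵃ eᵇ) (cong₂ _+_ eᶜ eᵈ)))

  bound : ∀ t → Dec (a ≡ t) → Dec (b ≡ t) → Dec (c ≡ t) → Dec (d ≡ t) → Q t ≤ p t
  bound _ (yes refl) _ _ _ =
    evaluate (var-diag a) (var-≢ (≢-sym a≢b)) (var-≢ (≢-sym a≢c)) (var-≢ (≢-sym a≢d)) pa
  bound _ (no a≢t) (yes refl) _ _ =
    evaluate (var-≢ a≢t) (var-diag b) (var-≢ (≢-sym b≢c)) (var-≢ (≢-sym b≢d)) pb
  bound _ (no a≢t) (no b≢t) (yes refl) _ =
    evaluate (var-≢ a≢t) (var-≢ b≢t) (var-diag c) (var-≢ (≢-sym c≢d)) pc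
  bound _ (no a≢t) (no b≢t) (no c≢t) (yes refl) =
    evaluate (var-≢ a≢t) (var-≢ b≢t) (var-≢ c≢t) (var-diag d) pd
  bound _ (no a≢t) (no b≢t) (no c≢t) (no d≢t) =
    evaluate (var-≢ a≢t) (var-≢ b≢t) (var-≢ c≢t) (var-≢ d≢t) z≤n

twoEdgesAt⇒GenI2 : (G : Graph n) → Support p v → TwoEdgesAt G (Support p) v →
                   ∃[ q ] GenI2 G q × q ∣ₘ p × Support q v
twoEdgesAt⇒GenI2 {v = v} G pv (twoEdges b c d v~b c~d v≢c v≢d b≢c b≢d pb pc pd) =
  (var v · var b) · (var c · var d) ,
  (v , b , c , d , v~b , c~d , λ _ → refl) ,
  distinct-vars-∣ₘ (adj⇒≢ G v~b) v≢c v≢d b≢c b≢d (adj⇒≢ G c~d) pv pb pc pd ,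
  ≤-trans (edge-hasˡ v b) (m≤m+n _ _)

InL-neighbour : (G : Graph n) → InL G p → Support p t → ∃[ x ] Adj G t x × Support p x
InL-neighbour {p = p} {t} G (S , GS , S≈p) pt
  with lcmList-support S GS (subst (1 ≤_) (sym (S≈p t)) pt)
... | q , (i , j , i~j , q≈) , q∣S , qt = other (edge-support {i = i} {j} (subst (1 ≤_) (q≈ t) qt))
  where
  endpoint : ∀ {x} → Support (var i · var j) x → Support p x
  endpoint {x} h = subst (1 ≤_) (S≈p x) (≤-trans h (subst (_≤ lcmList S x) (q≈ x) (q∣S x)))

  other : i ≡ t ⊎ j ≡ t → ∃[ x ] Adj G t x × Support p x
  other (inj₁ i≡t) = j , subst (λ s → Adj G s j) i≡t i~j , endpoint (edge-hasʳ i j)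
  other (inj₂ j≡t) = i , subst (λ s → Adj G s i) j≡t (adj-sym G i~j) , endpoint (edge-hasˡ i j)

module _ (G : Graph n) (claw-free : ClawFree G)
         (p∈L : InL G p) (sq : Squarefree p) (deg≥4 : 4 ≤ deg p) where

  vertex-GenI2 : Adj G v u → Support p v → Support p u → ∃[ q ] GenI2 G q × q ∣ₘ p × Support q v
  vertex-GenI2 {v} {u} v~u pv pu
    with fresh-support sq (u ∷ v ∷ []) (≤-trans (n≤1+n 3) deg≥4)
  ... | w₁ , p₁ , u≢₁ ∷ v≢₁ ∷ []
    with fresh-support sq (u ∷ v ∷ w₁ ∷ []) deg≥4
  ... | w₂ , p₂ , u≢₂ ∷ v≢₂ ∷ ₁≢₂ ∷ [] =
    twoEdgesAt⇒GenI2 G pv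
      (edge-twoEdgesAt G claw-free (Support p) (InL-neighbour G p∈L)
        v~u pu p₁ p₂ u≢₁ v≢₁ u≢₂ v≢₂ ₁≢₂)

  GenI-refines-GenI2 : Refines (GenI G) (GenI2 G) p
  GenI-refines-GenI2 {e} (i , j , i~j , e≈) e∣p =
    cover (vertex-GenI2 i~j (support (edge-hasˡ i j)) (support (edge-hasʳ i j)))
          (vertex-GenI2 (adj-sym G i~j) (support (edge-hasʳ i j)) (support (edge-hasˡ i j)))
    where
    support : ∀ {x} → Support (var i · var j) x → Support p x
    support {x} h = ≤-trans h (subst (_≤ p x) (e≈ x) (e∣p x))

    cover : ∃[ q ] GenI2 G q × q ∣ₘ p × Support q i → ∃[ q ] GenI2 G q × q ∣ₘ p × Support q j →
            Σ (List (Mon _)) λ T → All (GenI2 G) T × lcmList T ∣ₘ p × e ∣ₘ lcmList T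
    cover (qᵢ , Gqᵢ , qᵢ∣p , qᵢi) (qⱼ , Gqⱼ , qⱼ∣p , qⱼj) =
      qᵢ ∷ qⱼ ∷ [] , Gqᵢ ∷ Gqⱼ ∷ [] ,
      lcmList-least (qᵢ ∷ qⱼ ∷ []) (qᵢ∣p ∷ qⱼ∣p ∷ []) ,
      squarefree-∣ₘ (λ t → ≤-trans (e∣p t) (sq t)) covered
      where
      covered : ∀ t → Support e t → Support (lcmList (qᵢ ∷ qⱼ ∷ [])) t
      covered t h with edge-support {i = i} {j} (subst (1 ≤_) (e≈ t) h)
      ... | inj₁ refl = ≤-trans qᵢi (m≤m⊔n (qᵢ i) _)
      ... | inj₂ refl = ≤-trans qⱼj (≤-trans (m≤m⊔n (qⱼ j) 0) (m≤n⊔m (qᵢ j) _))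

lemma5p6 : ∀ (n : ℕ) (G : Graph n) → ClawFree G → NoInducedC4Compl G →
    ∀ (m : Mon n) → InL2 G m → Squarefree m →
    ∀ (p : Mon n) →
      (InHalfOpen (InL2 G) m p → InHalfOpen (InL4 G) m p) ×
      (InHalfOpen (InL4 G) m p → InHalfOpen (InL2 G) m p)
lemma5p6 n G claw-free _ m _ sq-m p = L²⇒L₄ , L₄⇒L²
  where
  squarefree : p ∣ₘ m → Squarefree p
  squarefree p∣m t = ≤-trans (p∣m t) (sq-m t)

  L²⇒L₄ : InHalfOpen (InL2 G) m p → InHalfOpen (InL4 G) m p
  L²⇒L₄ (p∈L² , p≉1 , p∣m) with InLcmLattice-nontrivial p∈L² p≉1
  ... | q , Gq , q∣p =
    (InLcmLattice-refine (GenI2-refines-GenI G (squarefree p∣m)) p∈L² ,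
     subst (_≤ deg p) (deg-GenI2 G Gq) (deg-mono q∣p)) ,
    p≉1 , p∣m

  L₄⇒L² : InHalfOpen (InL4 G) m p → InHalfOpen (InL2 G) m p
  L₄⇒L² ((p∈L , deg≥4) , p≉1 , p∣m) =
    InLcmLattice-refine (GenI-refines-GenI2 G claw-free p∈L (squarefree p∣m) deg≥4) p∈L ,
    p≉1 , p∣m
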